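{- Let $k\ge 2$ and let $G$ be a graph on $k$ vertices with weakly decreasing degree sequence $(d_1,\ldots,d_k)$ satisfying $d_1=k-2$. Then there exists a graph $G'$ with the same degree sequence as $G$ such that $S(G')\ge S(G)$ and some vertex of degree $d_1$ in $G'$ is adjacent to all other vertices except one vertex of minimal degree.
   Context: All graphs are finite and simple. For a graph $G$, $S(G)=\sum_{uv\in E(G)}\min(\deg u,\deg v)$. -}

module Defs where

open import Data.Nat using (ℕ; zero; suc; _+_; _⊔_; _⊓_; _<ᵇ_)
open import Data.Fin using (Fin; toℕ)
import Data.Fin as Fin
open import Data.Bool using (Bool; true; false; if_then_else_; _∧_)
open import Relation.Binary.PropositionalEquality using (_≡_)

sumFin : ∀ {n} → (Fin n → ℕ) → ℕ
sumFin {zero}  f = 0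
sumFin {suc n} f = f Fin.zero + sumFin (λ i → f (Fin.suc i))

record Graph (k : ℕ) : Set where
  field
    adj   : Fin k → Fin k → Bool
    sym   : ∀ u v → adj u v ≡ adj v u
    irrefl : ∀ v → adj v v ≡ false
open Graph public

deg : ∀ {k} → Graph k → Fin k → ℕ
deg G v = sumFin (λ u → if adj G v u then 1 else 0)

S : ∀ {k} → Graph k → ℕ
S G = sumFin (λ u → sumFin (λ v →
        if adj G u v ∧ (toℕ u <ᵇ toℕ v) then deg G u ⊓ deg G v else 0))

-- The vertex v of degree k − 2 misses exactly one other vertex x. If x already has
-- minimum degree, G itself works. Otherwise take w of minimum degree: deg w < deg x ≤ deg v
-- forces w ∉ {v, x}, so v ~ w. As v ∈ N(w) ∖ N(x), the inequality deg w < deg x means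
-- N(x) ⊄ N(w) ∪ {w}: some y ~ x has y ≠ w and y ≁ w. The 2-switch trading the edges vw, xy
-- for vx, wy keeps every degree and changes S by
--   min(d v, d x) + min(d w, d y) − min(d v, d w) − min(d x, d y) = d x − min(d x, d y) ≥ 0,
-- and afterwards the only vertex v misses is the minimum-degree vertex w.
module Submission where

open import Defs
open import Data.Nat using (ℕ; zero; suc; pred; _+_; _⊓_; _<ᵇ_; _≤_; _<_; _∸_; z≤n; s≤s)
open import Data.Nat.Properties
  using ( +-identityʳ; +-comm; +-mono-≤; +-monoʳ-≤; +-cancelʳ-≡; +-cancelʳ-≤; +-commutativeSemigroup
        ; ≤-refl; ≤-trans; ≰⇒>; <⇒≱; <-irrefl; m<m+n; m<1+n⇒m≤n; _≤?_
        ; ⊓-comm; m⊓n≤m; m≤n⇒m⊓n≡m; m≥n⇒m⊓n≡n; module ≤-Reasoning )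
open import Algebra.Properties.CommutativeSemigroup +-commutativeSemigroup using (interchange)
open import Data.Fin using (Fin; toℕ)
import Data.Fin as Fin
open import Data.Fin.Properties using (_≟_; toℕ-injective; ¬∀⟶∃¬)
open import Data.Bool using (Bool; true; false; if_then_else_; _∧_; _∨_; not)
import Data.Bool as Bool
open import Data.Bool.Properties using (∨-identityʳ; ∨-zeroʳ; ∧-zeroʳ; ∨-comm; ∧-comm; ¬-not)
open import Data.Product using (Σ; _×_; _,_; proj₁; proj₂; uncurry)
open import Data.Sum using (_⊎_; inj₁; inj₂; [_,_]′)
open import Data.Empty using (⊥-elim)
open import Data.List using (allFin)
open import Data.List.Extrema.Nat using (argmin; f[argmin]≤f[xs])
open import Data.List.Membership.Propositional.Properties using (∈-allFin)
import Data.List.Relation.Unary.All as All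
open import Function using (_∘_)
open import Function.Bundles using (_↔_; Inverse)
open import Function.Properties.Inverse using (↔-refl)
open import Relation.Nullary using (¬_; Dec; yes; no; does)
open import Relation.Nullary.Decidable using (¬?; _→-dec_; dec-false)
open import Relation.Binary.PropositionalEquality using (_≡_; _≢_; refl; cong; cong₂; module ≡-Reasoning)
import Relation.Binary.PropositionalEquality as ≡

private
  variable
    n : ℕ
    a b c d u t : Fin n

[_]·_ : Bool → ℕ → ℕ
[ b ]· m = if b then m else 0

[]·-∧ : ∀ p q m → [ p ∧ q ]· m ≡ [ p ]· [ q ]· m
[]·-∧ true  q m = refl
[]·-∧ false q m = refl

[]·-∨ : ∀ {p q} m → (p ≡ true → q ≡ false) → [ p ∨ q ]· m ≡ [ p ]· m + [ q ]· m
[]·-∨ {true}  {false} m _ = ≡.sym (+-identityʳ m)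
[]·-∨ {true}  {true}  m p⇒¬q with p⇒¬q refl
... | ()
[]·-∨ {false}         m _ = refl

[]·-mono-≤ : ∀ {p q} m → (p ≡ true → q ≡ true) → [ p ]· m ≤ [ q ]· m
[]·-mono-≤ {false}         m _ = z≤n
[]·-mono-≤ {true}  {true}  m _ = ≤-refl
[]·-mono-≤ {true}  {false} m p⇒q with p⇒q refl
... | ()

[]·-<ᵇ-either : ∀ i j → i ≢ j → ∀ m → [ i <ᵇ j ]· m + [ j <ᵇ i ]· m ≡ m
[]·-<ᵇ-either zero    zero    i≢j m = ⊥-elim (i≢j refl)
[]·-<ᵇ-either zero    (suc j) _   m = +-identityʳ m
[]·-<ᵇ-either (suc i) zero    _   m = refl
[]·-<ᵇ-either (suc i) (suc j) i≢j m = []·-<ᵇ-either i j (i≢j ∘ cong suc) m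

does-∧ : ∀ {P Q : Set} (p : Dec P) (q : Dec Q) → does p ∧ does q ≡ true → P × Q
does-∧ (yes p) (yes q) _  = p , q
does-∧ (yes _) (no _)  ()
does-∧ (no _)  _       ()

sumFin-cong : {f g : Fin n → ℕ} → (∀ i → f i ≡ g i) → sumFin f ≡ sumFin g
sumFin-cong {zero}  f≗g = refl
sumFin-cong {suc n} f≗g = cong₂ _+_ (f≗g Fin.zero) (sumFin-cong (f≗g ∘ Fin.suc))

sumFin-mono-≤ : {f g : Fin n → ℕ} → (∀ i → f i ≤ g i) → sumFin f ≤ sumFin g
sumFin-mono-≤ {zero}  f≤g = z≤n
sumFin-mono-≤ {suc n} f≤g = +-mono-≤ (f≤g Fin.zero) (sumFin-mono-≤ (f≤g ∘ Fin.suc))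

sumFin-distrib-+ : (f g : Fin n → ℕ) → sumFin (λ i → f i + g i) ≡ sumFin f + sumFin g
sumFin-distrib-+ {zero}  f g = refl
sumFin-distrib-+ {suc n} f g = ≡.trans
  (cong (f Fin.zero + g Fin.zero +_) (sumFin-distrib-+ (f ∘ Fin.suc) (g ∘ Fin.suc)))
  (interchange (f Fin.zero) (g Fin.zero) _ _)

sumFin-zero : sumFin {n} (λ _ → 0) ≡ 0
sumFin-zero {zero}  = refl
sumFin-zero {suc n} = sumFin-zero {n}

sumFin-one : sumFin {n} (λ _ → 1) ≡ n
sumFin-one {zero}  = refl
sumFin-one {suc n} = cong suc (sumFin-one {n})

sumFin-[]· : ∀ p (f : Fin n → ℕ) → sumFin (λ i → [ p ]· f i) ≡ [ p ]· sumFin f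
sumFin-[]·     true  f = refl
sumFin-[]· {n} false f = sumFin-zero {n}

-- Indicators use does rather than ⌊_⌋: only does reduces through the map′ in Fin.suc i ≟ Fin.suc a.
sumFin-select : ∀ (a : Fin n) (f : Fin n → ℕ) → sumFin (λ i → [ does (i ≟ a) ]· f i) ≡ f a
sumFin-select {suc n} Fin.zero    f = ≡.trans (cong (f Fin.zero +_) (sumFin-zero {n})) (+-identityʳ _)
sumFin-select {suc n} (Fin.suc a) f = sumFin-select a (f ∘ Fin.suc)

sumFin-select-∧ : ∀ p (b : Fin n) (f : Fin n → ℕ) → sumFin (λ i → [ p ∧ does (i ≟ b) ]· f i) ≡ [ p ]· f b
sumFin-select-∧ p b f = ≡.trans (sumFin-cong (λ i → []·-∧ p _ (f i)))
  (≡.trans (sumFin-[]· p (λ i → [ does (i ≟ b) ]· f i)) (cong ([ p ]·_) (sumFin-select b f)))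

sumFin-[∨] : ∀ {p q : Fin n → Bool} (f : Fin n → ℕ) → (∀ i → p i ≡ true → q i ≡ false) →
  sumFin (λ i → [ p i ∨ q i ]· f i) ≡ sumFin (λ i → [ p i ]· f i) + sumFin (λ i → [ q i ]· f i)
sumFin-[∨] {p = p} {q} f disjoint = ≡.trans (sumFin-cong (λ i → []·-∨ (f i) (disjoint i)))
  (sumFin-distrib-+ (λ i → [ p i ]· f i) (λ i → [ q i ]· f i))

count : (Fin n → Bool) → ℕ
count p = sumFin λ i → [ p i ]· 1

count≡0⇒none : ∀ (p : Fin n → Bool) → count p ≡ 0 → ∀ i → p i ≡ false
count≡0⇒none p none (Fin.suc i) with p Fin.zero
... | false = count≡0⇒none (p ∘ Fin.suc) none i
count≡0⇒none p none Fin.zero with p Fin.zero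
... | false = refl

count≡1⇒unique : ∀ (p : Fin n → Bool) → count p ≡ 1 →
  Σ (Fin n) λ x → p x ≡ true × (∀ u → p u ≡ true → u ≡ x)
count≡1⇒unique {suc n} p one with p Fin.zero in p₀
... | true  = Fin.zero , p₀ , onlyZero
  where
  onlyZero : ∀ u → p u ≡ true → u ≡ Fin.zero
  onlyZero Fin.zero    _  = refl
  onlyZero (Fin.suc u) pu with ≡.trans (≡.sym pu) (count≡0⇒none (p ∘ Fin.suc) (cong pred one) u)
  ... | ()
... | false with count≡1⇒unique (p ∘ Fin.suc) one
...   | x , px , unique = Fin.suc x , px , unique′
  where
  unique′ : ∀ u → p u ≡ true → u ≡ Fin.suc x
  unique′ Fin.zero    pu with ≡.trans (≡.sym pu) p₀
  ... | ()
  unique′ (Fin.suc u) pu = cong Fin.suc (unique u pu)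

count-< : ∀ {p q : Fin n → Bool} → (∀ i → p i ≡ true → q i ≡ true) → p a ≡ false → q a ≡ true →
  count p < count q
count-< {a = a} {p} {q} p⊆q pa qa = begin-strict
  count p                                         <⟨ m<m+n (count p) (s≤s z≤n) ⟩
  count p + 1                                     ≡⟨ cong (count p +_) (≡.sym (sumFin-select a (λ _ → 1))) ⟩
  count p + sumFin (λ i → [ does (i ≟ a) ]· 1)    ≡⟨ ≡.sym (sumFin-[∨] (λ _ → 1) p⇒≢a) ⟩
  sumFin (λ i → [ p i ∨ does (i ≟ a) ]· 1)        ≤⟨ sumFin-mono-≤ (λ i → []·-mono-≤ 1 (p∨a⊆q i)) ⟩
  count q                                         ∎
  where
  open ≤-Reasoning
  p⇒≢a : ∀ i → p i ≡ true → does (i ≟ a) ≡ false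
  p⇒≢a i pi with i ≟ a
  ... | no _     = refl
  ... | yes refl with ≡.trans (≡.sym pi) pa
  ...   | ()
  p∨a⊆q : ∀ i → p i ∨ does (i ≟ a) ≡ true → q i ≡ true
  p∨a⊆q i p∨a with i ≟ a
  ... | yes refl = qa
  ... | no _     = p⊆q i (≡.trans (≡.sym (∨-identityʳ (p i))) p∨a)

adjacent⇒≢ : ∀ (G : Graph n) → adj G u t ≡ true → u ≢ t
adjacent⇒≢ {u = u} G u~t refl with ≡.trans (≡.sym u~t) (irrefl G u)
... | ()

nonNeighbour : Graph n → Fin n → Fin n → Bool
nonNeighbour G v t = not (adj G v t ∨ does (t ≟ v))

nonNeighbour⇒ : ∀ (G : Graph n) {v t} → nonNeighbour G v t ≡ true → t ≢ v × adj G v t ≡ false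
nonNeighbour⇒ G {v} {t} _ with adj G v t | t ≟ v
... | false | no t≢v = t≢v , refl

⇒nonNeighbour : ∀ (G : Graph n) {v t} → t ≢ v → adj G v t ≡ false → nonNeighbour G v t ≡ true
⇒nonNeighbour G {v} {t} t≢v v≁t with t ≟ v
... | yes t≡v = ⊥-elim (t≢v t≡v)
... | no _ rewrite v≁t = refl

deg-+-nonNeighbours : ∀ (G : Graph n) v → deg G v + (count (nonNeighbour G v) + 1) ≡ n
deg-+-nonNeighbours {n} G v = begin
  deg G v + (count (nonNeighbour G v) + 1)
    ≡⟨ cong (λ m → deg G v + (count (nonNeighbour G v) + m)) (≡.sym (sumFin-select v (λ _ → 1))) ⟩
  deg G v + (count (nonNeighbour G v) + sumFin (λ t → [ does (t ≟ v) ]· 1))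
    ≡⟨ cong (deg G v +_) (≡.sym (sumFin-distrib-+ (λ t → [ nonNeighbour G v t ]· 1) (λ t → [ does (t ≟ v) ]· 1))) ⟩
  deg G v + sumFin (λ t → [ nonNeighbour G v t ]· 1 + [ does (t ≟ v) ]· 1)
    ≡⟨ ≡.sym (sumFin-distrib-+ (λ t → [ adj G v t ]· 1) (λ t → [ nonNeighbour G v t ]· 1 + [ does (t ≟ v) ]· 1)) ⟩
  sumFin (λ t → [ adj G v t ]· 1 + ([ nonNeighbour G v t ]· 1 + [ does (t ≟ v) ]· 1))
    ≡⟨ sumFin-cong partition ⟩
  sumFin {n} (λ _ → 1)
    ≡⟨ sumFin-one ⟩
  n ∎
  where
  open ≡-Reasoning
  partition : ∀ t → [ adj G v t ]· 1 + ([ nonNeighbour G v t ]· 1 + [ does (t ≟ v) ]· 1) ≡ 1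
  partition t with t ≟ v
  ... | yes refl rewrite irrefl G v = refl
  ... | no _ with adj G v t
  ...   | true  = refl
  ...   | false = refl

uniqueNonNeighbour : ∀ {k} (G : Graph (suc (suc k))) v → deg G v ≡ k →
  Σ (Fin (suc (suc k))) λ x → (x ≢ v × adj G v x ≡ false) × (∀ u → u ≢ v → u ≢ x → adj G v u ≡ true)
uniqueNonNeighbour {k} G v deg≡k with count≡1⇒unique (nonNeighbour G v) one
  where
  one : count (nonNeighbour G v) ≡ 1
  one = +-cancelʳ-≡ 1 _ 1 (+-cancelʳ-≡ k _ 2 (begin
    count (nonNeighbour G v) + 1 + k         ≡⟨ +-comm (count (nonNeighbour G v) + 1) k ⟩
    k + (count (nonNeighbour G v) + 1)       ≡⟨ cong (_+ (count (nonNeighbour G v) + 1)) (≡.sym deg≡k) ⟩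
    deg G v + (count (nonNeighbour G v) + 1) ≡⟨ deg-+-nonNeighbours G v ⟩
    2 + k                                    ∎))
    where open ≡-Reasoning
... | x , nonNeighbour-x , unique = x , nonNeighbour⇒ G nonNeighbour-x , adjacentElsewhere
  where
  adjacentElsewhere : ∀ u → u ≢ v → u ≢ x → adj G v u ≡ true
  adjacentElsewhere u u≢v u≢x with adj G v u in v~u
  ... | true  = refl
  ... | false = ⊥-elim (u≢x (unique u (⇒nonNeighbour G u≢v v~u)))

minimiser : ∀ (f : Fin (suc n) → ℕ) → Σ (Fin (suc n)) λ w → ∀ u → f w ≤ f u
minimiser {n} f = argmin f Fin.zero (allFin (suc n)) ,
  λ u → All.lookup (f[argmin]≤f[xs] {f = f} Fin.zero (allFin (suc n))) (∈-allFin u)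

⊆-closedNeighbourhood⇒deg-≤ : ∀ (G : Graph n) {x w v} →
  (∀ t → adj G x t ≡ true → t ≢ w → adj G w t ≡ true) →
  adj G x v ≡ false → adj G w v ≡ true → deg G x ≤ deg G w
⊆-closedNeighbourhood⇒deg-≤ G {x} {w} {v} N[x]⊆N[w] x≁v w~v = m<1+n⇒m≤n (begin-strict
  deg G x                                         <⟨ count-< ⊆closed x≁v (cong (_∨ does (v ≟ w)) w~v) ⟩
  count (λ t → adj G w t ∨ does (t ≟ w))          ≡⟨ sumFin-[∨] (λ _ → 1) loopless ⟩
  deg G w + sumFin (λ t → [ does (t ≟ w) ]· 1)    ≡⟨ cong (deg G w +_) (sumFin-select w (λ _ → 1)) ⟩
  deg G w + 1                                     ≡⟨ +-comm (deg G w) 1 ⟩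
  suc (deg G w)                                   ∎)
  where
  open ≤-Reasoning
  ⊆closed : ∀ t → adj G x t ≡ true → adj G w t ∨ does (t ≟ w) ≡ true
  ⊆closed t x~t with t ≟ w
  ... | yes _  = ∨-zeroʳ (adj G w t)
  ... | no t≢w = ≡.trans (∨-identityʳ (adj G w t)) (N[x]⊆N[w] t x~t t≢w)
  loopless : ∀ t → adj G w t ≡ true → does (t ≟ w) ≡ false
  loopless t w~t = dec-false (t ≟ w) (adjacent⇒≢ G w~t ∘ ≡.sym)

deg-<⇒neighbour-∉-closedNeighbourhood : ∀ (G : Graph n) {x w v} →
  adj G v x ≡ false → adj G v w ≡ true → deg G w < deg G x →
  Σ (Fin n) λ y → adj G x y ≡ true × y ≢ w × adj G w y ≡ false
deg-<⇒neighbour-∉-closedNeighbourhood {n} G {x} {w} {v} v≁x v~w w<x with ¬∀⟶∃¬ n Inside inside? notAllInside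
  where
  Inside : Fin n → Set
  Inside t = adj G x t ≡ true → t ≢ w → adj G w t ≡ true
  inside? : ∀ t → Dec (Inside t)
  inside? t = (adj G x t Bool.≟ true) →-dec (¬? (t ≟ w) →-dec (adj G w t Bool.≟ true))
  notAllInside : ¬ (∀ t → Inside t)
  notAllInside allInside = <⇒≱ w<x (⊆-closedNeighbourhood⇒deg-≤ G allInside
    (≡.trans (sym G x v) v≁x) (≡.trans (sym G w v) v~w))
... | y , outside = y , escape outside
  where
  escape : ∀ {y} → ¬ (adj G x y ≡ true → y ≢ w → adj G w y ≡ true) →
    adj G x y ≡ true × y ≢ w × adj G w y ≡ false
  escape {y} outside with adj G x y | y ≟ w | adj G w y
  ... | true  | no y≢w  | false = refl , y≢w , refl
  ... | true  | no _    | true  = ⊥-elim (outside λ _ _ → refl)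
  ... | true  | yes y≡w | _     = ⊥-elim (outside λ _ y≢w → ⊥-elim (y≢w y≡w))
  ... | false | _       | _     = ⊥-elim (outside λ ())

Rel : ℕ → Set
Rel n = Fin n → Fin n → Bool

_∪_ : Rel n → Rel n → Rel n
(A ∪ B) u t = A u t ∨ B u t

edge : Fin n → Fin n → Rel n
edge a b u t = (does (u ≟ a) ∧ does (t ≟ b)) ∨ (does (u ≟ b) ∧ does (t ≟ a))

edge-sym : ∀ (a b : Fin n) u t → edge a b u t ≡ edge a b t u
edge-sym a b u t = ≡.trans (∨-comm (does (u ≟ a) ∧ does (t ≟ b)) _)
  (cong₂ _∨_ (∧-comm (does (u ≟ b)) _) (∧-comm (does (u ≟ a)) _))

edge-ends : ∀ (a b u t : Fin n) → edge a b u t ≡ true → (u ≡ a × t ≡ b) ⊎ (u ≡ b × t ≡ a)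
edge-ends a b u t e with does (u ≟ a) ∧ does (t ≟ b) in forward
... | true  = inj₁ (does-∧ (u ≟ a) (t ≟ b) forward)
... | false = inj₂ (does-∧ (u ≟ b) (t ≟ a) e)

edge-self : ∀ (a b : Fin n) → edge a b a b ≡ true
edge-self a b with a ≟ a | b ≟ b
... | yes _  | yes _  = refl
... | no a≢a | _      = ⊥-elim (a≢a refl)
... | _      | no b≢b = ⊥-elim (b≢b refl)

edge-avoidsˡ : ∀ t → u ≢ a → u ≢ b → edge a b u t ≡ false
edge-avoidsˡ t u≢a u≢b = ¬-not λ e → [ u≢a ∘ proj₁ , u≢b ∘ proj₁ ]′ (edge-ends _ _ _ t e)

edge-avoidsʳ : ∀ u → t ≢ a → t ≢ b → edge a b u t ≡ false
edge-avoidsʳ u t≢a t≢b = ¬-not λ e → [ t≢b ∘ proj₂ , t≢a ∘ proj₂ ]′ (edge-ends _ _ u _ e)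

edge-irrefl : a ≢ b → ∀ u → edge a b u u ≡ false
edge-irrefl a≢b u = ¬-not λ e → [ (λ { (refl , refl) → a≢b refl }) , (λ { (refl , refl) → a≢b refl }) ]′
  (edge-ends _ _ u u e)

edge-disjoint : ∀ b → a ≢ c → a ≢ d → ∀ u t → edge a b u t ≡ true → edge c d u t ≡ false
edge-disjoint b a≢c a≢d u t e with edge-ends _ b u t e
... | inj₁ (refl , _) = edge-avoidsˡ t a≢c a≢d
... | inj₂ (_ , refl) = edge-avoidsʳ u a≢c a≢d

edge-adj : ∀ (G : Graph n) a b u t → edge a b u t ≡ true → adj G u t ≡ adj G a b
edge-adj G a b u t e with edge-ends a b u t e
... | inj₁ (refl , refl) = refl
... | inj₂ (refl , refl) = sym G b a

edges-adj : ∀ (G : Graph n) {β} a b c d → adj G a b ≡ β → adj G c d ≡ β →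
  ∀ u t → (edge a b ∪ edge c d) u t ≡ true → adj G u t ≡ β
edges-adj G a b c d ab cd u t e with edge a b u t in e₁
... | true  = ≡.trans (edge-adj G a b u t e₁) ab
... | false = ≡.trans (edge-adj G c d u t e) cd

edge-rowSum : a ≢ b → ∀ u (f : Fin n → ℕ) →
  sumFin (λ t → [ edge a b u t ]· f t) ≡ [ does (u ≟ a) ]· f b + [ does (u ≟ b) ]· f a
edge-rowSum {a = a} {b} a≢b u f = ≡.trans
  (sumFin-[∨] f endpointsDistinct)
  (cong₂ _+_ (sumFin-select-∧ (does (u ≟ a)) b f) (sumFin-select-∧ (does (u ≟ b)) a f))
  where
  endpointsDistinct : ∀ t → does (u ≟ a) ∧ does (t ≟ b) ≡ true → does (u ≟ b) ∧ does (t ≟ a) ≡ false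
  endpointsDistinct t e with does-∧ (u ≟ a) (t ≟ b) e
  ... | refl , _ rewrite dec-false (u ≟ b) a≢b = refl

disjointEdges-rowSum : a ≢ b → c ≢ d → a ≢ c → a ≢ d → ∀ u →
  sumFin (λ t → [ (edge a b ∪ edge c d) u t ]· 1)
    ≡ ([ does (u ≟ a) ]· 1 + [ does (u ≟ b) ]· 1) + ([ does (u ≟ c) ]· 1 + [ does (u ≟ d) ]· 1)
disjointEdges-rowSum {b = b} a≢b c≢d a≢c a≢d u = ≡.trans
  (sumFin-[∨] (λ _ → 1) (edge-disjoint b a≢c a≢d u))
  (cong₂ _+_ (edge-rowSum a≢b u (λ _ → 1)) (edge-rowSum c≢d u (λ _ → 1)))

weight : Rel n → (Fin n → Fin n → ℕ) → ℕ
weight A C = sumFin λ u → sumFin λ t → [ A u t ]· C u t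

weight-∪ : ∀ {A B : Rel n} C → (∀ u t → A u t ≡ true → B u t ≡ false) →
  weight (A ∪ B) C ≡ weight A C + weight B C
weight-∪ {A = A} {B} C disjoint = ≡.trans (sumFin-cong λ u → sumFin-[∨] (C u) (disjoint u))
  (sumFin-distrib-+ (λ u → sumFin (λ t → [ A u t ]· C u t)) (λ u → sumFin (λ t → [ B u t ]· C u t)))

edge-weight : a ≢ b → (C : Fin n → Fin n → ℕ) → weight (edge a b) C ≡ C a b + C b a
edge-weight {a = a} {b} a≢b C = begin
  weight (edge a b) C
    ≡⟨ sumFin-cong (λ u → edge-rowSum a≢b u (C u)) ⟩
  sumFin (λ u → [ does (u ≟ a) ]· C u b + [ does (u ≟ b) ]· C u a)
    ≡⟨ sumFin-distrib-+ (λ u → [ does (u ≟ a) ]· C u b) (λ u → [ does (u ≟ b) ]· C u a) ⟩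
  sumFin (λ u → [ does (u ≟ a) ]· C u b) + sumFin (λ u → [ does (u ≟ b) ]· C u a)
    ≡⟨ cong₂ _+_ (sumFin-select a (λ u → C u b)) (sumFin-select b (λ u → C u a)) ⟩
  C a b + C b a ∎
  where open ≡-Reasoning

upper : (Fin n → Fin n → ℕ) → Fin n → Fin n → ℕ
upper D u t = [ toℕ u <ᵇ toℕ t ]· D u t

edge-upperWeight : a ≢ b → ∀ {D : Fin n → Fin n → ℕ} → D b a ≡ D a b → weight (edge a b) (upper D) ≡ D a b
edge-upperWeight {a = a} {b} a≢b {D} D-sym = begin
  weight (edge a b) (upper D)
    ≡⟨ edge-weight a≢b (upper D) ⟩
  upper D a b + upper D b a
    ≡⟨ cong (λ m → upper D a b + [ toℕ b <ᵇ toℕ a ]· m) D-sym ⟩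
  [ toℕ a <ᵇ toℕ b ]· D a b + [ toℕ b <ᵇ toℕ a ]· D a b
    ≡⟨ []·-<ᵇ-either (toℕ a) (toℕ b) (a≢b ∘ toℕ-injective) (D a b) ⟩
  D a b ∎
  where open ≡-Reasoning

disjointEdges-upperWeight : a ≢ b → c ≢ d → a ≢ c → a ≢ d →
  ∀ {D : Fin n → Fin n → ℕ} → (∀ u t → D u t ≡ D t u) →
  weight (edge a b ∪ edge c d) (upper D) ≡ D a b + D c d
disjointEdges-upperWeight {b = b} a≢b c≢d a≢c a≢d D-sym = ≡.trans
  (weight-∪ (upper _) (edge-disjoint b a≢c a≢d))
  (cong₂ _+_ (edge-upperWeight a≢b (D-sym _ _)) (edge-upperWeight c≢d (D-sym _ _)))

S≡weight : ∀ (G : Graph n) {f : Fin n → ℕ} → (∀ u → deg G u ≡ f u) →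
  S G ≡ weight (adj G) (upper (λ u t → f u ⊓ f t))
S≡weight G {f} deg≗f = sumFin-cong λ u → sumFin-cong λ t → ≡.trans
  ([]·-∧ (adj G u t) (toℕ u <ᵇ toℕ t) (deg G u ⊓ deg G t))
  (cong (λ m → [ adj G u t ]· [ toℕ u <ᵇ toℕ t ]· m) (cong₂ _⊓_ (deg≗f u) (deg≗f t)))

[]·-rewire : ∀ {x r p} m → (r ≡ true → x ≡ true) → (p ≡ true → x ≡ false) →
  [ (x ∧ not r) ∨ p ]· m + [ r ]· m ≡ [ x ]· m + [ p ]· m
[]·-rewire {true}  {false} {false} m _ _ = refl
[]·-rewire {false} {false} {false} m _ _ = refl
[]·-rewire {true}  {true}  {false} m _ _ = ≡.sym (+-identityʳ m)
[]·-rewire {false} {false} {true}  m _ _ = +-identityʳ m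
[]·-rewire {false} {true}          m r⇒x _ with r⇒x refl
... | ()
[]·-rewire {true}          {p = true} m _ p⇒¬x with p⇒¬x refl
... | ()

module Rewiring (G : Graph n) (removed added : Rel n)
  (removed-sym : ∀ u t → removed u t ≡ removed t u)
  (added-sym : ∀ u t → added u t ≡ added t u)
  (added-irrefl : ∀ u → added u u ≡ false)
  (removed⊆G : ∀ u t → removed u t ≡ true → adj G u t ≡ true)
  (added∩G : ∀ u t → added u t ≡ true → adj G u t ≡ false)
  where

  rewiredAdj : Rel n
  rewiredAdj u t = (adj G u t ∧ not (removed u t)) ∨ added u t

  rewired : Graph n
  rewired = record { adj = rewiredAdj ; sym = rewiredAdj-sym ; irrefl = rewiredAdj-irrefl }
    where
    rewiredAdj-sym : ∀ u t → rewiredAdj u t ≡ rewiredAdj t u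
    rewiredAdj-sym u t rewrite sym G u t | removed-sym u t | added-sym u t = refl
    rewiredAdj-irrefl : ∀ u → rewiredAdj u u ≡ false
    rewiredAdj-irrefl u rewrite irrefl G u | added-irrefl u = refl

  rewired-removes : removed u t ≡ true → rewiredAdj u t ≡ false
  rewired-removes {u} {t} r with added u t in p
  ... | false rewrite r = ≡.trans (∨-identityʳ (adj G u t ∧ false)) (∧-zeroʳ (adj G u t))
  ... | true with ≡.trans (≡.sym (removed⊆G u t r)) (added∩G u t p)
  ...   | ()

  rewired-adds : added u t ≡ true → rewiredAdj u t ≡ true
  rewired-adds {u} {t} p rewrite p = ∨-zeroʳ (adj G u t ∧ not (removed u t))

  rewired-keeps : removed u t ≡ false → adj G u t ≡ true → rewiredAdj u t ≡ true
  rewired-keeps r u~t rewrite r | u~t = refl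

  rowSum-rewired : ∀ u (f : Fin n → ℕ) →
    sumFin (λ t → [ rewiredAdj u t ]· f t) + sumFin (λ t → [ removed u t ]· f t)
      ≡ sumFin (λ t → [ adj G u t ]· f t) + sumFin (λ t → [ added u t ]· f t)
  rowSum-rewired u f = begin
    sumFin (λ t → [ rewiredAdj u t ]· f t) + sumFin (λ t → [ removed u t ]· f t)
      ≡⟨ ≡.sym (sumFin-distrib-+ (λ t → [ rewiredAdj u t ]· f t) (λ t → [ removed u t ]· f t)) ⟩
    sumFin (λ t → [ rewiredAdj u t ]· f t + [ removed u t ]· f t)
      ≡⟨ sumFin-cong (λ t → []·-rewire (f t) (removed⊆G u t) (added∩G u t)) ⟩
    sumFin (λ t → [ adj G u t ]· f t + [ added u t ]· f t)
      ≡⟨ sumFin-distrib-+ (λ t → [ adj G u t ]· f t) (λ t → [ added u t ]· f t) ⟩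
    sumFin (λ t → [ adj G u t ]· f t) + sumFin (λ t → [ added u t ]· f t) ∎
    where open ≡-Reasoning

  weight-rewired : ∀ C → weight rewiredAdj C + weight removed C ≡ weight (adj G) C + weight added C
  weight-rewired C = begin
    weight rewiredAdj C + weight removed C
      ≡⟨ ≡.sym (sumFin-distrib-+ (λ u → sumFin (λ t → [ rewiredAdj u t ]· C u t)) (λ u → sumFin (λ t → [ removed u t ]· C u t))) ⟩
    sumFin (λ u → sumFin (λ t → [ rewiredAdj u t ]· C u t) + sumFin (λ t → [ removed u t ]· C u t))
      ≡⟨ sumFin-cong (λ u → rowSum-rewired u (C u)) ⟩
    sumFin (λ u → sumFin (λ t → [ adj G u t ]· C u t) + sumFin (λ t → [ added u t ]· C u t))
      ≡⟨ sumFin-distrib-+ (λ u → sumFin (λ t → [ adj G u t ]· C u t)) (λ u → sumFin (λ t → [ added u t ]· C u t)) ⟩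
    weight (adj G) C + weight added C ∎
    where open ≡-Reasoning

module TwoSwitch (G : Graph n) {a b c d : Fin n}
  (a~b : adj G a b ≡ true) (c~d : adj G c d ≡ true) (a≁c : adj G a c ≡ false) (b≁d : adj G b d ≡ false)
  (a≢c : a ≢ c) (b≢d : b ≢ d)
  where

  a≢b : a ≢ b
  a≢b = adjacent⇒≢ G a~b

  c≢d : c ≢ d
  c≢d = adjacent⇒≢ G c~d

  a≢d : a ≢ d
  a≢d refl with ≡.trans (≡.sym c~d) (≡.trans (sym G c a) a≁c)
  ... | ()

  open Rewiring G (edge a b ∪ edge c d) (edge a c ∪ edge b d)
    (λ u t → cong₂ _∨_ (edge-sym a b u t) (edge-sym c d u t))
    (λ u t → cong₂ _∨_ (edge-sym a c u t) (edge-sym b d u t))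
    (λ u → cong₂ _∨_ (edge-irrefl a≢c u) (edge-irrefl b≢d u))
    (edges-adj G a b c d a~b c~d)
    (edges-adj G a c b d a≁c b≁d)
    public

  deg-rewired≗deg : ∀ u → deg rewired u ≡ deg G u
  deg-rewired≗deg u = +-cancelʳ-≡ ((ι a + ι b) + (ι c + ι d)) (deg rewired u) (deg G u) (begin
    deg rewired u + ((ι a + ι b) + (ι c + ι d))
      ≡⟨ cong (deg rewired u +_) (≡.sym (disjointEdges-rowSum a≢b c≢d a≢c a≢d u)) ⟩
    deg rewired u + sumFin (λ t → [ (edge a b ∪ edge c d) u t ]· 1)
      ≡⟨ rowSum-rewired u (λ _ → 1) ⟩
    deg G u + sumFin (λ t → [ (edge a c ∪ edge b d) u t ]· 1)
      ≡⟨ cong (deg G u +_) (disjointEdges-rowSum a≢c b≢d a≢b a≢d u) ⟩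
    deg G u + ((ι a + ι c) + (ι b + ι d))
      ≡⟨ cong (deg G u +_) (interchange (ι a) (ι c) (ι b) (ι d)) ⟩
    deg G u + ((ι a + ι b) + (ι c + ι d)) ∎)
    where
    open ≡-Reasoning
    ι : Fin n → ℕ
    ι x = [ does (u ≟ x) ]· 1

  minDeg : Fin n → Fin n → ℕ
  minDeg u t = deg G u ⊓ deg G t

  S-rewired : S rewired + (minDeg a b + minDeg c d) ≡ S G + (minDeg a c + minDeg b d)
  S-rewired = begin
    S rewired + (minDeg a b + minDeg c d)
      ≡⟨ cong₂ _+_ (S≡weight rewired deg-rewired≗deg)
                   (≡.sym (disjointEdges-upperWeight a≢b c≢d a≢c a≢d minDeg-sym)) ⟩
    weight rewiredAdj (upper minDeg) + weight (edge a b ∪ edge c d) (upper minDeg)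
      ≡⟨ weight-rewired (upper minDeg) ⟩
    weight (adj G) (upper minDeg) + weight (edge a c ∪ edge b d) (upper minDeg)
      ≡⟨ cong₂ _+_ (≡.sym (S≡weight G (λ _ → refl)))
                   (disjointEdges-upperWeight a≢c b≢d a≢b a≢d minDeg-sym) ⟩
    S G + (minDeg a c + minDeg b d) ∎
    where
    open ≡-Reasoning
    minDeg-sym : ∀ u t → minDeg u t ≡ minDeg t u
    minDeg-sym u t = ⊓-comm (deg G u) (deg G t)

  S-rewired-≥ : minDeg a b + minDeg c d ≤ minDeg a c + minDeg b d → S G ≤ S rewired
  S-rewired-≥ gain = +-cancelʳ-≤ (minDeg a c + minDeg b d) (S G) (S rewired) (begin
    S G + (minDeg a c + minDeg b d)       ≡⟨ ≡.sym S-rewired ⟩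
    S rewired + (minDeg a b + minDeg c d) ≤⟨ +-monoʳ-≤ (S rewired) gain ⟩
    S rewired + (minDeg a c + minDeg b d) ∎)
    where open ≤-Reasoning

  rewired-a≁b : adj rewired a b ≡ false
  rewired-a≁b = rewired-removes (cong (_∨ edge c d a b) (edge-self a b))

  rewired-a~ : (∀ u → u ≢ a → u ≢ c → adj G a u ≡ true) → ∀ u → u ≢ a → u ≢ b → adj rewired a u ≡ true
  rewired-a~ a~others u u≢a u≢b = byCases (u ≟ c)
    where
    byCases : Dec (u ≡ c) → adj rewired a u ≡ true
    byCases (yes refl) = rewired-adds (cong (_∨ edge b d a c) (edge-self a c))
    byCases (no u≢c)   = rewired-keeps (cong₂ _∨_ (edge-avoidsʳ a u≢a u≢b) (edge-avoidsˡ u a≢c a≢d))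
                                       (a~others u u≢a u≢c)

⊓-exchange-≤ : ∀ {p q r s} → q ≤ p → q ≤ s → r ≤ p → p ⊓ q + r ⊓ s ≤ p ⊓ r + q ⊓ s
⊓-exchange-≤ {p} {q} {r} {s} q≤p q≤s r≤p = begin
  p ⊓ q + r ⊓ s ≡⟨ cong (_+ r ⊓ s) (m≥n⇒m⊓n≡n q≤p) ⟩
  q + r ⊓ s     ≤⟨ +-monoʳ-≤ q (m⊓n≤m r s) ⟩
  q + r         ≡⟨ +-comm q r ⟩
  r + q         ≡⟨ ≡.sym (cong₂ _+_ (m≥n⇒m⊓n≡n r≤p) (m≤n⇒m⊓n≡m q≤s)) ⟩
  p ⊓ r + q ⊓ s ∎
  where open ≤-Reasoning

record Improvement (G : Graph n) (v : Fin n) : Set where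
  field
    graph       : Graph n
    deg-≗       : ∀ u → deg graph u ≡ deg G u
    S-≤         : S G ≤ S graph
    missing     : Fin n
    missing≢v   : missing ≢ v
    missing-min : ∀ u → deg G missing ≤ deg G u
    v≁missing   : adj graph v missing ≡ false
    v~others    : ∀ u → u ≢ v → u ≢ missing → adj graph v u ≡ true

improvement : ∀ {k} (G : Graph (suc (suc k))) → (∀ u → deg G u ≤ k) → ∀ v → deg G v ≡ k →
  ∀ w → (∀ u → deg G w ≤ deg G u) → Improvement G v
improvement G deg≤k v deg-v≡k w w-min with uniqueNonNeighbour G v deg-v≡k
... | x , (x≢v , v≁x) , v~others with deg G x ≤? deg G w
...   | yes x≤w = record
  { graph = G ; deg-≗ = λ _ → refl ; S-≤ = ≤-refl
  ; missing = x ; missing≢v = x≢v ; missing-min = λ u → ≤-trans x≤w (w-min u)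
  ; v≁missing = v≁x ; v~others = v~others
  }
...   | no x≰w = switchAlong (deg-<⇒neighbour-∉-closedNeighbourhood G v≁x v~w w<x)
  where
  w<x : deg G w < deg G x
  w<x = ≰⇒> x≰w
  x≤v : deg G x ≤ deg G v
  x≤v = ≡.subst (deg G x ≤_) (≡.sym deg-v≡k) (deg≤k x)
  w≢v : w ≢ v
  w≢v refl = <⇒≱ w<x x≤v
  w≢x : w ≢ x
  w≢x refl = <-irrefl refl w<x
  v~w : adj G v w ≡ true
  v~w = v~others w w≢v w≢x
  switchAlong : Σ (Fin _) (λ y → adj G x y ≡ true × y ≢ w × adj G w y ≡ false) → Improvement G v
  switchAlong (y , x~y , y≢w , w≁y) = record
    { graph = rewired ; deg-≗ = deg-rewired≗deg ; S-≤ = S-rewired-≥ (⊓-exchange-≤ (w-min v) (w-min y) x≤v)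
    ; missing = w ; missing≢v = w≢v ; missing-min = w-min
    ; v≁missing = rewired-a≁b ; v~others = rewired-a~ v~others
    }
    where open TwoSwitch G v~w x~y v≁x w≁y (x≢v ∘ ≡.sym) (y≢w ∘ ≡.sym)

lemma6 : (k : ℕ) → 2 ≤ k → (G : Graph k)
    → (∀ v → deg G v ≤ k ∸ 2)
    → (Σ (Fin k) λ v → deg G v ≡ k ∸ 2)
    → Σ (Graph k) λ G′
        → (Σ (Fin k ↔ Fin k) λ σ → ∀ v → deg G′ (Inverse.to σ v) ≡ deg G v)
        × (S G ≤ S G′)
        × (Σ (Fin k) λ v → Σ (Fin k) λ w
            → deg G′ v ≡ k ∸ 2
            × ¬ (w ≡ v)
            × (∀ u → deg G′ w ≤ deg G′ u)
            × adj G′ v w ≡ false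
            × (∀ u → ¬ (u ≡ v) → ¬ (u ≡ w) → adj G′ v u ≡ true))
lemma6 (suc (suc k)) (s≤s (s≤s z≤n)) G deg≤k (v , deg-v≡k) =
  graph , (↔-refl , deg-≗) , S-≤ ,
  v , missing , ≡.trans (deg-≗ v) deg-v≡k , missing≢v ,
  (λ u → ≡.subst₂ _≤_ (≡.sym (deg-≗ missing)) (≡.sym (deg-≗ u)) (missing-min u)) , v≁missing , v~others
  where open Improvement (uncurry (improvement G deg≤k v deg-v≡k) (minimiser (deg G)))
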